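{- Define the infinite matrix $M=(m_{j,k})_{j,k\ge1}$ by: $m_{1,1}=8$, $m_{1,k}=0$ for $k\ge2$; $m_{2,1}=1$, $m_{2,2}=128$, $m_{2,k}=0$ for $k\ge3$; $m_{j,1}=0$ for $j\ge3$; and $m_{j,k}=16m_{j-1,k-1}+m_{j-2,k-1}$ for $j\ge3$, $k\ge2$. Define the infinite matrix $(x_{\alpha,j})_{\alpha,j\ge1}$ by $x_{1,1}=8$, $x_{1,k}=0$ for $k\ge2$, and \[x_{\alpha+1,j}=\begin{cases}\sum_{i=1}^{\infty}x_{\alpha,i}\,m_{3i,i+j} & \text{if } \alpha \text{ is odd},\\ \sum_{i=1}^{\infty}x_{\alpha,i}\,m_{3i+1,i+j} & \text{if } \alpha \text{ is even}.\end{cases}\] For an integer $n$, let $\vartheta_2(n)$ be the exponent of the highest power of $2$ dividing $n$, with $\vartheta_2(0)=+\infty$. Then for all positive integers $j$ and $k$, \[\vartheta_2(x_{2j-1,k})\ge 3j+7(k-1)\quad\text{and}\quad \vartheta_2(x_{2j,k})\ge 3(j+1)+8(k-1),\] and in both inequalities equality holds when $k=1$.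
   Context: The sums defining $x_{\alpha+1,j}$ have only finitely many nonzero terms. -}

module Defs where

open import Data.Nat using (ℕ; zero; suc; _+_; _*_; _∸_; _^_; _≤_; _<_)
open import Data.Nat.Divisibility using (_∣_)
open import Data.Product using (_×_; ∃-syntax)
open import Relation.Nullary using (¬_)
open import Relation.Binary.PropositionalEquality using (_≡_)

-- The infinite matrix M = (m_{j,k})_{j,k ≥ 1}, indices 1-based.
-- Values with an index 0 are junk (never used).
m : ℕ → ℕ → ℕ
m zero _ = 0
m (suc _) zero = 0
m 1 1 = 8
m 1 (suc (suc _)) = 0
m 2 1 = 1
m 2 2 = 128
m 2 (suc (suc (suc _))) = 0
m (suc (suc (suc _))) 1 = 0
m (suc (suc (suc j))) (suc (suc k)) = 16 * m (suc (suc j)) (suc k) + m (suc j) (suc k)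

sumTo : ℕ → (ℕ → ℕ) → ℕ
sumTo zero f = 0
sumTo (suc N) f = sumTo N f + f (suc N)

offset : ℕ → ℕ
offset zero = 1
offset (suc zero) = 0
offset (suc (suc α)) = offset α

term : (ℕ → ℕ → ℕ) → ℕ → ℕ → ℕ → ℕ
term x α i j = x α i * m (3 * i + offset α) (i + j)

-- The (infinite) sum over i ≥ 1 has only finitely many nonzero terms:
-- there is N beyond which all terms vanish, and the sum is the finite
-- sum up to N.
IsX : (ℕ → ℕ → ℕ) → Set
IsX x =
  (x 1 1 ≡ 8) ×
  (∀ k → 2 ≤ k → x 1 k ≡ 0) ×
  (∀ α j → 1 ≤ α → 1 ≤ j →
     ∃[ N ] ((∀ i → N < i → term x α i j ≡ 0) ×
             (x (suc α) j ≡ sumTo N (λ i → term x α i j))))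

-- ϑ₂(n) ≥ a  (with ϑ₂(0) = +∞)
ϑ₂≥ : ℕ → ℕ → Set
ϑ₂≥ n a = 2 ^ a ∣ n

-- ϑ₂(n) = a  (false for n = 0 since ϑ₂(0) = +∞)
ϑ₂≡ : ℕ → ℕ → Set
ϑ₂≡ n a = (2 ^ a ∣ n) × ¬ (2 ^ suc a ∣ n)

module Submission where

-- Write ϑ(n) for the 2-adic valuation.  The entries of M satisfy
-- the uniform bound  ϑ(m_{r,c}) ≥ 8c − 4r − 1, stated without subtraction as
-- 2^(8c) ∣ 2^(4r+1) · m_{r,c}  (induction along the recurrence).  A term
-- x_{α,i} m_{3i+o,i+k} of the sum defining x_{α+1,k} therefore gains at least
-- 8(i+k) − 12i − 4o − 1 over the valuation of x_{α,i}.  Inserting the claimed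
-- bounds for row α shows every term meets the claimed bound for row α + 1,
-- and that for k = 1 all terms with i ≥ 2 are divisible by a strictly larger
-- power of 2 than the first term  x_{α,1} m_{3+o,2}, where m_{3,2} = 24 and
-- m_{4,2} = 1; so the first term determines ϑ(x_{α+1,1}) exactly.

open import Defs
open import Data.Nat using (ℕ; zero; suc; _+_; _*_; _∸_; _≤_; _<_; _^_; s≤s; z≤n)
open import Data.Nat.Properties
open import Data.Nat.Divisibility
open import Data.Nat.Tactic.RingSolver using (solve-∀)
open import Data.Product using (_×_; _,_; proj₁; proj₂)
open import Relation.Nullary using (¬_)
open import Relation.Binary.PropositionalEquality

record Exactly (a n : ℕ) : Set where
  constructor odd-multiple
  field
    odd-part : ℕ
    factored : n ≡ 2 ^ a * suc (2 * odd-part)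

odd-not-even : ∀ q → ¬ (2 ∣ suc (2 * q))
odd-not-even q (divides s eq) = even≢odd s q (sym (trans eq (*-comm s 2)))

exact⇒ϑ₂≡ : ∀ {a n} → Exactly a n → ϑ₂≡ n a
exact⇒ϑ₂≡ {a} (odd-multiple q refl) = m∣m*n (suc (2 * q)) , not-higher
  where
  not-higher : ¬ (2 ^ suc a ∣ 2 ^ a * suc (2 * q))
  not-higher d = odd-not-even q
    (*-cancelˡ-∣ (2 ^ a) {{m^n≢0 2 a}} (subst (_∣ 2 ^ a * suc (2 * q)) (*-comm 2 (2 ^ a)) d))

exact-add : ∀ {a t r} → Exactly a t → 2 ^ suc a ∣ r → Exactly a (t + r)
exact-add {a} (odd-multiple q refl) (divides s refl) = odd-multiple (q + s) (shift (2 ^ a) q s)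
  where
  shift : ∀ P q s → P * suc (2 * q) + s * (2 * P) ≡ P * suc (2 * (q + s))
  shift = solve-∀

exact-mul : ∀ {a b u v} → Exactly a u → Exactly b v → Exactly (a + b) (u * v)
exact-mul {a} {b} (odd-multiple q refl) (odd-multiple r refl) = odd-multiple (q + r + 2 * q * r)
  (trans (product (2 ^ a) (2 ^ b) q r) (cong (_* _) (sym (^-distribˡ-+-* 2 a b))))
  where
  product : ∀ P R q r → P * suc (2 * q) * (R * suc (2 * r))
                        ≡ P * R * suc (2 * (q + r + 2 * q * r))
  product = solve-∀

-- If 2^A ∣ u and ϑ(w) ≥ c − s (written 2^c ∣ 2^s w), then ϑ(u w) ≥ T
-- whenever T + s ≤ A + c (the slack being e).
shifted-product : ∀ {A c s u w} T e → 2 ^ A ∣ u → 2 ^ c ∣ 2 ^ s * w →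
                  T + s + e ≡ A + c → 2 ^ T ∣ u * w
shifted-product {A} {c} {s} {u} {w} T e du dw slack =
  *-cancelˡ-∣ (2 ^ s) {{m^n≢0 2 s}}
    (subst₂ _∣_ (trans (^-distribˡ-+-* 2 T s) (*-comm (2 ^ T) (2 ^ s))) (swap u (2 ^ s) w)
      (∣-trans power-le (subst (_∣ u * (2 ^ s * w)) (sym (^-distribˡ-+-* 2 A c)) (*-pres-∣ du dw))))
  where
  swap : ∀ u P w → u * (P * w) ≡ P * (u * w)
  swap = solve-∀
  power-le : 2 ^ (T + s) ∣ 2 ^ (A + c)
  power-le = subst (2 ^ (T + s) ∣_) (trans (sym (^-distribˡ-+-* 2 (T + s) e)) (cong (2 ^_) slack))
                   (m∣m*n (2 ^ e))

sum-divisible : ∀ {d} N f → (∀ i → d ∣ f (suc i)) → d ∣ sumTo N f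
sum-divisible zero    f h = _ ∣0
sum-divisible (suc N) f h = ∣m∣n⇒∣m+n (sum-divisible N f h) (h N)

sumTo-first : ∀ N f → sumTo (suc N) f ≡ f 1 + sumTo N (λ i → f (suc i))
sumTo-first zero    f = +-comm 0 (f 1)
sumTo-first (suc N) f =
  trans (cong (_+ f (suc (suc N))) (sumTo-first N f)) (+-assoc (f 1) _ _)

-- For the empty sum the vanishing
-- hypothesis gives f 1 = 0, so the sum still equals its first term.
sum-exact : ∀ {a} N f → (∀ i → N < i → f i ≡ 0) → Exactly a (f 1) →
            (∀ i → 2 ^ suc a ∣ f (suc (suc i))) → Exactly a (sumTo N f)
sum-exact {a} zero    f vanish first rest = subst (Exactly a) (vanish 1 (s≤s z≤n)) first
sum-exact {a} (suc N) f vanish first rest =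
  subst (Exactly a) (sym (sumTo-first N f)) (exact-add first (sum-divisible N _ rest))

private
  zero-entry : ∀ r c → 2 ^ c ∣ 2 ^ r * 0
  zero-entry r c = subst (2 ^ c ∣_) (sym (*-zeroʳ (2 ^ r))) (_ ∣0)

  weight-step : ∀ r → 2 ^ (4 * suc r + 1) ≡ 16 * 2 ^ (4 * r + 1)
  weight-step r = trans (cong (λ n → 2 ^ (n + 1)) (*-suc 4 r)) (^-distribˡ-+-* 2 4 (4 * r + 1))

  recurrence-weights : ∀ P a b → 256 * (16 * P * a + P * b) ≡ 16 * (16 * P) * (16 * a + b)
  recurrence-weights = solve-∀

m-bound : ∀ r c → 2 ^ (8 * c) ∣ 2 ^ (4 * r + 1) * m r c
m-bound zero c = zero-entry (4 * 0 + 1) (8 * c)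
m-bound (suc r) zero = zero-entry (4 * suc r + 1) 0
m-bound 1 1 = ∣-refl
m-bound 1 (suc (suc c)) = zero-entry 5 (8 * suc (suc c))
m-bound 2 1 = divides 2 refl
m-bound 2 2 = ∣-refl
m-bound 2 (suc (suc (suc c))) = zero-entry 9 (8 * suc (suc (suc c)))
m-bound (suc (suc (suc r))) 1 = zero-entry (4 * suc (suc (suc r)) + 1) 8
m-bound (suc (suc (suc r))) (suc (suc c)) =
  subst₂ _∣_ (trans (sym (^-distribˡ-+-* 2 8 (8 * suc c))) (cong (2 ^_) (sym (*-suc 8 (suc c)))))
             weights
    (*-monoʳ-∣ (2 ^ 8) (∣m∣n⇒∣m+n (m-bound (suc (suc r)) (suc c)) (m-bound (suc r) (suc c))))
  where
  a = m (suc (suc r)) (suc c)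
  b = m (suc r) (suc c)
  weights : 2 ^ 8 * (2 ^ (4 * suc (suc r) + 1) * a + 2 ^ (4 * suc r + 1) * b)
            ≡ 2 ^ (4 * suc (suc (suc r)) + 1) * (16 * a + b)
  weights = trans (cong (λ W → 256 * (W * a + P * b)) (weight-step (suc r)))
              (trans (recurrence-weights P a b)
                (cong (_* (16 * a + b)) (sym (trans (weight-step (suc (suc r)))
                                                    (cong (16 *_) (weight-step (suc r)))))))
    where P = 2 ^ (4 * suc r + 1)

term-divisible : ∀ x α i k {A o} T e → offset α ≡ o → 2 ^ A ∣ x α i →
                 T + (4 * (3 * i + o) + 1) + e ≡ A + 8 * (i + k) →
                 2 ^ T ∣ term x α i k
term-divisible x α i k {A} T e refl dx slack =
  shifted-product {A} {8 * (i + k)} {4 * (3 * i + offset α) + 1} T e dx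
                  (m-bound (3 * i + offset α) (i + k)) slack

Valuations : (ℕ → ℕ) → ℕ → ℕ → Set
Valuations row b s = (∀ k → 2 ^ (b + s * k) ∣ row (suc k)) × Exactly b (row 1)

-- Rows 2j + 1 and 2j + 2 are written suc (dbl j) and dbl (suc j), so that
-- their parities (the offset in the recurrence for x) compute by induction.
dbl : ℕ → ℕ
dbl zero    = 0
dbl (suc n) = suc (suc (dbl n))

dbl-spec : ∀ n → 2 * n ≡ dbl n
dbl-spec zero    = refl
dbl-spec (suc n) = trans (*-suc 2 n) (cong (λ d → suc (suc d)) (dbl-spec n))

offset-odd : ∀ n → offset (suc (dbl n)) ≡ 0
offset-odd zero    = refl
offset-odd (suc n) = offset-odd n

offset-even : ∀ n → offset (dbl (suc n)) ≡ 1
offset-even zero    = refl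
offset-even (suc n) = offset-even n

module Rows (x : ℕ → ℕ → ℕ) (isX : IsX x) where

  row-divisible : ∀ α k T → (∀ i → 2 ^ T ∣ term x (suc α) (suc i) (suc k)) →
                  2 ^ T ∣ x (suc (suc α)) (suc k)
  row-divisible α k T h with proj₂ (proj₂ isX) (suc α) (suc k) (s≤s z≤n) (s≤s z≤n)
  ... | N , _ , sum = subst (2 ^ T ∣_) (sym sum) (sum-divisible N _ h)

  row-exact : ∀ α b → Exactly b (term x (suc α) 1 1) →
              (∀ i → 2 ^ suc b ∣ term x (suc α) (suc (suc i)) 1) →
              Exactly b (x (suc (suc α)) 1)
  row-exact α b first rest with proj₂ (proj₂ isX) (suc α) 1 (s≤s z≤n) (s≤s z≤n)
  ... | N , vanish , sum = subst (Exactly b) (sym sum) (sum-exact N _ vanish first rest)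

  first-row : Valuations (x 1) 3 7
  first-row = bound , odd-multiple 0 (proj₁ isX)
    where
    bound : ∀ k → 2 ^ (3 + 7 * k) ∣ x 1 (suc k)
    bound zero    = subst (8 ∣_) (sym (proj₁ isX)) ∣-refl
    bound (suc k) = subst (_ ∣_) (sym (proj₁ (proj₂ isX) (suc (suc k)) (s≤s (s≤s z≤n)))) (_ ∣0)

  -- From an odd row to the next row; its first term is x_{α,1} · m_{3,2} = x_{α,1} · 24.
  odd-step : ∀ α b → offset (suc α) ≡ 0 → Valuations (x (suc α)) b 7 →
             Valuations (x (suc (suc α))) (b + 3) 8
  odd-step α b odd (bound , exact) =
    (λ k → row-divisible α k (b + 3 + 8 * k) λ i →
       term-divisible x (suc α) (suc i) (suc k) (b + 3 + 8 * k) (3 * i) odd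
                      (bound i) (slack b i k)) ,
    row-exact α (b + 3) first λ i →
       term-divisible x (suc α) (suc (suc i)) 1 (suc (b + 3)) (3 * i + 2) odd
                      (bound (suc i)) (slack-tail b i)
    where
    -- Exponent bookkeeping for term i + 1 in column k + 1, and for the terms
    -- i + 2 ≥ 2 of column 1 (which must exceed the first term's valuation).
    slack : ∀ b i k → b + 3 + 8 * k + (4 * (3 * suc i + 0) + 1) + 3 * i
                      ≡ b + 7 * i + 8 * (suc i + suc k)
    slack = solve-∀
    slack-tail : ∀ b i → suc (b + 3) + (4 * (3 * suc (suc i) + 0) + 1) + (3 * i + 2)
                         ≡ b + 7 * suc i + 8 * (suc (suc i) + 1)
    slack-tail = solve-∀
    first : Exactly (b + 3) (term x (suc α) 1 1)
    first = subst (λ o → Exactly (b + 3) (x (suc α) 1 * m (3 + o) 2)) (sym odd)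
                  (exact-mul exact (odd-multiple 1 refl))

  -- From an even row to the next row; its first term is x_{α,1} · m_{4,2} = x_{α,1}.
  even-step : ∀ α b → offset (suc α) ≡ 1 → Valuations (x (suc α)) b 8 →
              Valuations (x (suc (suc α))) b 7
  even-step α b even (bound , exact) =
    (λ k → row-divisible α k (b + 7 * k) (terms k)) ,
    row-exact α b (subst (Exactly b) (sym first-term) exact) λ i →
       term-divisible x (suc α) (suc (suc i)) 1 (suc b) (4 * i + 2) even
                      (bound (suc i)) (slack-tail b i)
    where
    first-term : term x (suc α) 1 1 ≡ x (suc α) 1
    first-term = trans (cong (λ o → x (suc α) 1 * m (3 + o) 2) even) (*-identityʳ _)
    -- Exponent bookkeeping; only the term (i, k) = (1, 1) has no slack and is
    -- handled by first-term instead.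
    slack-first : ∀ b k → b + 7 * suc k + (4 * (3 * 1 + 1) + 1) + k
                          ≡ b + 8 * 0 + 8 * (1 + suc (suc k))
    slack-first = solve-∀
    slack : ∀ b i k → b + 7 * k + (4 * (3 * suc (suc i) + 1) + 1) + (4 * i + k + 3)
                      ≡ b + 8 * suc i + 8 * (suc (suc i) + suc k)
    slack = solve-∀
    slack-tail : ∀ b i → suc b + (4 * (3 * suc (suc i) + 1) + 1) + (4 * i + 2)
                         ≡ b + 8 * suc i + 8 * (suc (suc i) + 1)
    slack-tail = solve-∀
    terms : ∀ k i → 2 ^ (b + 7 * k) ∣ term x (suc α) (suc i) (suc k)
    terms zero    zero    = subst (_ ∣_) (sym first-term) (bound 0)
    terms (suc k) zero    = term-divisible x (suc α) 1 (suc (suc k)) (b + 7 * suc k) k even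
                              (bound 0) (slack-first b k)
    terms k       (suc i) = term-divisible x (suc α) (suc (suc i)) (suc k) (b + 7 * k) (4 * i + k + 3)
                              even (bound (suc i)) (slack b i k)

  odd-row  : ∀ j → Valuations (x (suc (dbl j))) (3 * suc j) 7
  even-row : ∀ j → Valuations (x (dbl (suc j))) (3 * (suc j + 1)) 8

  odd-row zero    = first-row
  odd-row (suc j) = subst (λ b → Valuations (x (suc (dbl (suc j)))) b 7) (three-times j)
                      (even-step (suc (dbl j)) (3 * (suc j + 1)) (offset-even j) (even-row j))
    where
    three-times : ∀ j → 3 * (suc j + 1) ≡ 3 * suc (suc j)
    three-times = solve-∀
  even-row j = subst (λ b → Valuations (x (dbl (suc j))) b 8) (three-times j)
                 (odd-step (dbl j) (3 * suc j) (offset-odd j) (odd-row j))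
    where
    three-times : ∀ j → 3 * suc j + 3 ≡ 3 * (suc j + 1)
    three-times = solve-∀

lemma4p2 : (x : ℕ → ℕ → ℕ) → IsX x →
    (∀ j k → 1 ≤ j → 1 ≤ k →
       ϑ₂≥ (x (2 * j ∸ 1) k) (3 * j + 7 * (k ∸ 1)) ×
       ϑ₂≥ (x (2 * j) k) (3 * (j + 1) + 8 * (k ∸ 1))) ×
    (∀ j → 1 ≤ j →
       ϑ₂≡ (x (2 * j ∸ 1) 1) (3 * j) ×
       ϑ₂≡ (x (2 * j) 1) (3 * (j + 1)))
lemma4p2 x isX = bounds , exact
  where
  open Rows x isX
  odd-index : ∀ j → 2 * suc j ∸ 1 ≡ suc (dbl j)
  odd-index j = cong (_∸ 1) (dbl-spec (suc j))
  bounds : ∀ j k → 1 ≤ j → 1 ≤ k →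
    ϑ₂≥ (x (2 * j ∸ 1) k) (3 * j + 7 * (k ∸ 1)) × ϑ₂≥ (x (2 * j) k) (3 * (j + 1) + 8 * (k ∸ 1))
  bounds (suc j) (suc k) _ _ =
    subst (λ r → ϑ₂≥ (x r (suc k)) (3 * suc j + 7 * k)) (sym (odd-index j)) (proj₁ (odd-row j) k) ,
    subst (λ r → ϑ₂≥ (x r (suc k)) (3 * (suc j + 1) + 8 * k)) (sym (dbl-spec (suc j)))
          (proj₁ (even-row j) k)
  exact : ∀ j → 1 ≤ j → ϑ₂≡ (x (2 * j ∸ 1) 1) (3 * j) × ϑ₂≡ (x (2 * j) 1) (3 * (j + 1))
  exact (suc j) _ =
    subst (λ r → ϑ₂≡ (x r 1) (3 * suc j)) (sym (odd-index j)) (exact⇒ϑ₂≡ (proj₂ (odd-row j))) ,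
    subst (λ r → ϑ₂≡ (x r 1) (3 * (suc j + 1))) (sym (dbl-spec (suc j)))
          (exact⇒ϑ₂≡ (proj₂ (even-row j)))
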